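{- In any execution of Algorithm 1 (described in the context), the network is in quiescence at some point of time if and only if every node $v$ has $\rho_{cw}(v)\ge\mathrm{ID}(v)$ at that point of time.
   Context: Oriented ring of $n$ nodes, content-oblivious asynchronous model (content-free pulses, arbitrary finite delays, no loss or injection; each node has an incoming queue per port). Each node $v$ has a unique positive integer ID $\mathrm{ID}(v)$. $\rho_{cw}(v)$ and $\sigma_{cw}(v)$ are the numbers of clockwise (CW) pulses node $v$ has received (consumed from its queue) and sent, initially 0. Algorithm 1 at node $v$: first send one CW pulse; then loop forever: if a CW pulse is waiting, consume it (incrementing $\rho_{cw}(v)$); then if $\rho_{cw}(v)=\mathrm{ID}(v)$ set state to Leader and send nothing, otherwise set state to Non-Leader and send one CW pulse. The network is in quiescence when no pulses are in transit, i.e., every sent pulse has been consumed (equivalently $\sum_v\sigma_{cw}(v)=\sum_v\rho_{cw}(v)$); times are considered at ends of loop iterations. -}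

module Defs where

open import Data.Nat using (ℕ; zero; suc; _+_; _∸_; _<_; _≤_; _≡ᵇ_)
open import Data.Nat.DivMod using (_mod_)
open import Data.Fin using (Fin; toℕ; _≟_)
open import Data.Bool using (if_then_else_)
open import Data.Product using (Σ; _×_)
open import Relation.Nullary using (yes; no)
open import Relation.Binary.PropositionalEquality using (_≡_)
open import Relation.Binary.Construct.Closure.ReflexiveTransitive using (Star)

cw : ∀ {n} → Fin n → Fin n
cw {suc m} i = suc (toℕ i) mod suc m

data Status : Set where
  undecided leader nonLeader : Status

-- Global configuration. chan v = number of CW pulses sent to v (by its
-- counter-clockwise neighbour) and not yet consumed by v (in transit or
-- waiting in v's incoming CW queue).
record Config (n : ℕ) : Set where
  field
    rho    : Fin n → ℕ
    sigma  : Fin n → ℕ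
    chan   : Fin n → ℕ
    status : Fin n → Status
open Config public

update : ∀ {n} {A : Set} → (Fin n → A) → Fin n → A → Fin n → A
update f v a w with w ≟ v
... | yes _ = a
... | no  _ = f w

-- Configuration right after every node executed its initial "send one CW pulse".
initial : ∀ {n} → Config n
initial = record
  { rho = λ _ → 0 ; sigma = λ _ → 1 ; chan = λ _ → 1 ; status = λ _ → undecided }

fire : ∀ {n} → (Fin n → ℕ) → Config n → Fin n → Config n
fire ID c v =
  let r   = rho c v + 1
      ch1 = update (chan c) v (chan c v ∸ 1)
  in if r ≡ᵇ ID v
     then record { rho = update (rho c) v r ; sigma = sigma c ; chan = ch1
                 ; status = update (status c) v leader }
     else record { rho = update (rho c) v r
                 ; sigma = update (sigma c) v (sigma c v + 1)
                 ; chan = update ch1 (cw v) (ch1 (cw v) + 1)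
                 ; status = update (status c) v nonLeader }

-- An (asynchronous) step: some node with a waiting pulse executes a loop
-- iteration. (Iterations with no waiting pulse change nothing.)
Step : ∀ {n} → (Fin n → ℕ) → Config n → Config n → Set
Step ID c c' = Σ _ λ v → (0 < chan c v) × (c' ≡ fire ID c v)

Reachable : ∀ {n} → (Fin n → ℕ) → Config n → Set
Reachable ID c = Star (Step ID) initial c

Quiescent : ∀ {n} → Config n → Set
Quiescent c = ∀ v → chan c v ≡ 0

-- A pulse sent by u is either still travelling to cw u or has been received
-- there, and u has sent one pulse more than it received, except for the single
-- pulse it swallows when its counter reaches ID u.  Hence, in every reachable
-- configuration and for every node u,
--   chan (cw u) + ρ (cw u) + [ID u ≤ ρ u] = ρ u + 1.
-- In quiescence this makes ρ non-decreasing clockwise, hence constant around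
-- the ring, which forces every indicator to be 1.  Conversely, if every
-- indicator is 1 then ρ is non-increasing clockwise, hence constant, which
-- forces every channel to be empty.
module Submission where

open import Defs
open import Data.Nat using (ℕ; zero; suc; _+_; _∸_; _<_; _≤_; _≥_; _≡ᵇ_; _%_; _≤?_; z≤n; s≤s⁻¹; NonZero)
open import Data.Nat.Properties hiding (_≟_)
open import Data.Nat.DivMod using (%-distribˡ-+; m%n%n≡m%n; [m+n]%n≡m%n; m<n⇒m%n≡m; m%n<n)
open import Algebra.Properties.CommutativeSemigroup +-commutativeSemigroup using (xy∙z≈xz∙y)
open import Data.Fin using (Fin; toℕ; _≟_)
open import Data.Fin.Properties using (toℕ-fromℕ<; toℕ-injective; toℕ<n)
open import Data.Bool using (true; false; T)
open import Data.Unit using (tt)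
open import Data.Product using (_×_; _,_)
open import Function using (flip; _∘′_)
open import Function.Bundles using (_⇔_; mk⇔)
open import Function.Definitions using (Injective)
open import Relation.Nullary using (yes; no; contradiction)
open import Relation.Binary.Core using (Rel)
open import Relation.Binary.Definitions using (Reflexive; Transitive)
open import Relation.Binary.PropositionalEquality
  using (_≡_; _≢_; refl; sym; trans; cong; cong₂; subst; module ≡-Reasoning)
open import Relation.Binary.Construct.Closure.ReflexiveTransitive using (Star; ε; _◅_)

update-same : ∀ {n} {A : Set} (f : Fin n → A) v a → update f v a v ≡ a
update-same f v a with v ≟ v
... | yes _  = refl
... | no v≢v = contradiction refl v≢v

update-other : ∀ {n} {A : Set} (f : Fin n → A) v a {w} → w ≢ v → update f v a w ≡ f w
update-other f v a {w} w≢v with w ≟ v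
... | yes w≡v = contradiction w≡v w≢v
... | no _    = refl

≡ᵇ-true⇒≡ : ∀ {m n} → (m ≡ᵇ n) ≡ true → m ≡ n
≡ᵇ-true⇒≡ {m} {n} eq = ≡ᵇ⇒≡ m n (subst T (sym eq) tt)

≡ᵇ-false⇒≢ : ∀ {m n} → (m ≡ᵇ n) ≡ false → m ≢ n
≡ᵇ-false⇒≢ {m} eq refl = subst T eq (≡⇒≡ᵇ m m refl)

[m%d+n]%d≡[m+n]%d : ∀ m n d .{{_ : NonZero d}} → (m % d + n) % d ≡ (m + n) % d
[m%d+n]%d≡[m+n]%d m n d = begin
  (m % d + n) % d            ≡⟨ %-distribˡ-+ (m % d) n d ⟩
  (m % d % d + n % d) % d    ≡⟨ cong (λ x → (x + n % d) % d) (m%n%n≡m%n m d) ⟩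
  (m % d + n % d) % d        ≡⟨ sym (%-distribˡ-+ m n d) ⟩
  (m + n) % d                ∎
  where open ≡-Reasoning

cw^ : ∀ {n} → ℕ → Fin n → Fin n
cw^ zero    v = v
cw^ (suc k) v = cw^ k (cw v)

module _ {m : ℕ} where

  toℕ-cw : (v : Fin (suc m)) → toℕ (cw v) ≡ suc (toℕ v) % suc m
  toℕ-cw v = toℕ-fromℕ< (m%n<n (suc (toℕ v)) (suc m))

  toℕ-cw^ : ∀ k (v : Fin (suc m)) → toℕ (cw^ k v) ≡ (toℕ v + k) % suc m
  toℕ-cw^ zero v = sym (trans (cong (_% suc m) (+-identityʳ (toℕ v))) (m<n⇒m%n≡m (toℕ<n v)))
  toℕ-cw^ (suc k) v = begin
    toℕ (cw^ k (cw v))                  ≡⟨ toℕ-cw^ k (cw v) ⟩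
    (toℕ (cw v) + k) % suc m            ≡⟨ cong (λ x → (x + k) % suc m) (toℕ-cw v) ⟩
    (suc (toℕ v) % suc m + k) % suc m   ≡⟨ [m%d+n]%d≡[m+n]%d (suc (toℕ v)) k (suc m) ⟩
    (suc (toℕ v) + k) % suc m           ≡⟨ cong (_% suc m) (sym (+-suc (toℕ v) k)) ⟩
    (toℕ v + suc k) % suc m             ∎
    where open ≡-Reasoning

  cw^-period : (v : Fin (suc m)) → cw^ (suc m) v ≡ v
  cw^-period v = toℕ-injective (begin
    toℕ (cw^ (suc m) v)      ≡⟨ toℕ-cw^ (suc m) v ⟩
    (toℕ v + suc m) % suc m  ≡⟨ [m+n]%n≡m%n (toℕ v) (suc m) ⟩
    toℕ v % suc m            ≡⟨ m<n⇒m%n≡m (toℕ<n v) ⟩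
    toℕ v                    ∎)
    where open ≡-Reasoning

  cw-cw^ : ∀ k (v : Fin (suc m)) → cw (cw^ k v) ≡ cw^ k (cw v)
  cw-cw^ zero    v = refl
  cw-cw^ (suc k) v = cw-cw^ k (cw v)

  ccw : Fin (suc m) → Fin (suc m)
  ccw = cw^ m

  ccw-cw : (v : Fin (suc m)) → ccw (cw v) ≡ v
  ccw-cw = cw^-period

  cw-ccw : (v : Fin (suc m)) → cw (ccw v) ≡ v
  cw-ccw v = trans (cw-cw^ m v) (cw^-period v)

  cw-injective : {u v : Fin (suc m)} → cw u ≡ cw v → u ≡ v
  cw-injective {u} {v} eq = trans (sym (ccw-cw u)) (trans (cong ccw eq) (ccw-cw v))

  -- Going clockwise m more times from cw w leads back to w.
  reverse-around-ring : ∀ {a ℓ} {A : Set a} {R : Rel A ℓ} → Reflexive R → Transitive R →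
    (g : Fin (suc m) → A) → (∀ w → R (g w) (g (cw w))) → ∀ w → R (g (cw w)) (g w)
  reverse-around-ring {R = R} R-refl R-trans g along w =
    subst (R (g (cw w))) (cong g (ccw-cw w)) (along-cw^ m (cw w))
    where
    along-cw^ : ∀ k v → R (g v) (g (cw^ k v))
    along-cw^ zero    v = R-refl
    along-cw^ (suc k) v = R-trans (along v) (along-cw^ k (cw v))

𝟙[_≤_] : ℕ → ℕ → ℕ
𝟙[ i ≤ r ] with i ≤? r
... | yes _ = 1
... | no  _ = 0

𝟙-yes : ∀ {i r} → i ≤ r → 𝟙[ i ≤ r ] ≡ 1
𝟙-yes {i} {r} i≤r with i ≤? r
... | yes _  = refl
... | no i≰r = contradiction i≤r i≰r

𝟙-no : ∀ {i r} → r < i → 𝟙[ i ≤ r ] ≡ 0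
𝟙-no {i} {r} r<i with i ≤? r
... | yes i≤r = contradiction i≤r (<⇒≱ r<i)
... | no _    = refl

𝟙≤1 : ∀ i r → 𝟙[ i ≤ r ] ≤ 1
𝟙≤1 i r with i ≤? r
... | yes _ = ≤-refl
... | no  _ = z≤n

𝟙-suc : ∀ {i r} → r + 1 ≢ i → 𝟙[ i ≤ r + 1 ] ≡ 𝟙[ i ≤ r ]
𝟙-suc {i} {r} r+1≢i rewrite +-comm r 1 with i ≤? r
... | yes i≤r = 𝟙-yes (m≤n⇒m≤1+n i≤r)
... | no i≰r  = 𝟙-no (≤∧≢⇒< (≰⇒> i≰r) r+1≢i)

[m∸1]+[n+1]≡m+n : ∀ {m} n → 0 < m → m ∸ 1 + (n + 1) ≡ m + n
[m∸1]+[n+1]≡m+n {suc m} n _ = trans (cong (m +_) (+-comm n 1)) (+-suc m n)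

m+n≡1+o∧n≤1⇒o≤m : ∀ {m n o} → m + n ≡ suc o → n ≤ 1 → o ≤ m
m+n≡1+o∧n≤1⇒o≤m {m} {n} {o} eq n≤1 = s≤s⁻¹ (begin
  suc o   ≡⟨ sym eq ⟩
  m + n   ≤⟨ +-monoʳ-≤ m n≤1 ⟩
  m + 1   ≡⟨ +-comm m 1 ⟩
  suc m   ∎)
  where open ≤-Reasoning

m+n≤n⇒m≡0 : ∀ {m n} → m + n ≤ n → m ≡ 0
m+n≤n⇒m≡0 {m} {n} le = n≤0⇒n≡0 (+-cancelʳ-≤ n m 0 le)

consume-preserves-chan+rho : ∀ {n} (c : Config n) v → 0 < chan c v → ∀ w →
  update (chan c) v (chan c v ∸ 1) w + update (rho c) v (rho c v + 1) w ≡ chan c w + rho c w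
consume-preserves-chan+rho c v pending w with w ≟ v
... | yes refl = [m∸1]+[n+1]≡m+n (rho c v) pending
... | no _     = refl

module _ {m : ℕ} (ID : Fin (suc m) → ℕ) where

  Delivered : Config (suc m) → Set
  Delivered c = ∀ u → chan c (cw u) + rho c (cw u) ≡ sigma c u

  SentPerReceived : Config (suc m) → Set
  SentPerReceived c = ∀ u → sigma c u + 𝟙[ ID u ≤ rho c u ] ≡ suc (rho c u)

  Balanced : Config (suc m) → Set
  Balanced c = ∀ u → chan c (cw u) + rho c (cw u) + 𝟙[ ID u ≤ rho c u ] ≡ suc (rho c u)

  module _ (c : Config (suc m)) (v : Fin (suc m)) (pending : 0 < chan c v) where

    private
      chan₁ rho₁ : Fin (suc m) → ℕ
      chan₁ = update (chan c) v (chan c v ∸ 1)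
      rho₁  = update (rho c) v (rho c v + 1)

    fire-delivered : Delivered c → Delivered (fire ID c v)
    fire-delivered del u with rho c v + 1 ≡ᵇ ID v | u ≟ v
    ... | true  | _        = trans (consume-preserves-chan+rho c v pending (cw u)) (del u)
    ... | false | yes refl = begin
      update chan₁ (cw v) (chan₁ (cw v) + 1) (cw v) + rho₁ (cw v)
        ≡⟨ cong (_+ rho₁ (cw v)) (update-same chan₁ (cw v) _) ⟩
      chan₁ (cw v) + 1 + rho₁ (cw v)
        ≡⟨ xy∙z≈xz∙y (chan₁ (cw v)) 1 (rho₁ (cw v)) ⟩
      chan₁ (cw v) + rho₁ (cw v) + 1
        ≡⟨ cong (_+ 1) (trans (consume-preserves-chan+rho c v pending (cw v)) (del v)) ⟩
      sigma c v + 1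
        ≡⟨ sym (update-same (sigma c) v _) ⟩
      update (sigma c) v (sigma c v + 1) v
        ∎
      where open ≡-Reasoning
    ... | false | no u≢v   = begin
      update chan₁ (cw v) (chan₁ (cw v) + 1) (cw u) + rho₁ (cw u)
        ≡⟨ cong (_+ rho₁ (cw u)) (update-other chan₁ (cw v) _ (u≢v ∘′ cw-injective)) ⟩
      chan₁ (cw u) + rho₁ (cw u)
        ≡⟨ consume-preserves-chan+rho c v pending (cw u) ⟩
      chan c (cw u) + rho c (cw u)
        ≡⟨ del u ⟩
      sigma c u
        ≡⟨ sym (update-other (sigma c) v _ u≢v) ⟩
      update (sigma c) v (sigma c v + 1) u
        ∎
      where open ≡-Reasoning

    fire-sentPerReceived : SentPerReceived c → SentPerReceived (fire ID c v)
    fire-sentPerReceived spr u with rho c v + 1 ≡ᵇ ID v in reached | u ≟ v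
    ... | true  | yes refl rewrite update-same (rho c) v (rho c v + 1) =
      cong₂ _+_ sigma≡ (𝟙-yes (≤-reflexive (sym (≡ᵇ-true⇒≡ reached))))
      where
      open ≡-Reasoning
      sigma≡ : sigma c v ≡ suc (rho c v)
      sigma≡ = begin
        sigma c v                            ≡⟨ sym (+-identityʳ _) ⟩
        sigma c v + 0                        ≡⟨ cong (sigma c v +_) (sym (𝟙-no rho<ID)) ⟩
        sigma c v + 𝟙[ ID v ≤ rho c v ]      ≡⟨ spr v ⟩
        suc (rho c v)                        ∎
        where
        rho<ID : rho c v < ID v
        rho<ID = ≤-reflexive (trans (+-comm 1 (rho c v)) (≡ᵇ-true⇒≡ reached))
    ... | false | yes refl
      rewrite update-same (rho c) v (rho c v + 1) | update-same (sigma c) v (sigma c v + 1) = begin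
      sigma c v + 1 + 𝟙[ ID v ≤ rho c v + 1 ]  ≡⟨ cong (sigma c v + 1 +_) (𝟙-suc (≡ᵇ-false⇒≢ reached)) ⟩
      sigma c v + 1 + 𝟙[ ID v ≤ rho c v ]      ≡⟨ xy∙z≈xz∙y (sigma c v) 1 _ ⟩
      sigma c v + 𝟙[ ID v ≤ rho c v ] + 1      ≡⟨ cong (_+ 1) (spr v) ⟩
      suc (rho c v) + 1                        ∎
      where open ≡-Reasoning
    ... | true  | no u≢v rewrite update-other (rho c) v (rho c v + 1) u≢v = spr u
    ... | false | no u≢v
      rewrite update-other (rho c) v (rho c v + 1) u≢v | update-other (sigma c) v (sigma c v + 1) u≢v = spr u

  Invariants : Config (suc m) → Set
  Invariants c = Delivered c × SentPerReceived c

  initial-invariants : (∀ v → 0 < ID v) → Invariants initial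
  initial-invariants ID>0 = (λ _ → refl) , λ u → cong (1 +_) (𝟙-no (ID>0 u))

  steps-preserve-invariants : ∀ {c c′} → Star (Step ID) c c′ → Invariants c → Invariants c′
  steps-preserve-invariants     ε                              inv         = inv
  steps-preserve-invariants {c} ((v , pending , refl) ◅ steps) (del , spr) =
    steps-preserve-invariants steps (fire-delivered c v pending del , fire-sentPerReceived c v pending spr)

  invariants⇒balanced : ∀ {c} → Invariants c → Balanced c
  invariants⇒balanced {c} (del , spr) u = trans (cong (_+ 𝟙[ ID u ≤ rho c u ]) (del u)) (spr u)

module _ {m : ℕ} (ID : Fin (suc m) → ℕ) (c : Config (suc m)) (balanced : Balanced ID c) where

  balanced⇒quiescent⇒ID≤rho : Quiescent c → ∀ v → ID v ≤ rho c v
  balanced⇒quiescent⇒ID≤rho quiet v with ID v ≤? rho c v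
  ... | yes ID≤rho = ID≤rho
  ... | no  ID≰rho = contradiction rho-cw≤rho (<⇒≱ rho<rho-cw)
    where
    open ≡-Reasoning
    quiet-balance : ∀ u → rho c (cw u) + 𝟙[ ID u ≤ rho c u ] ≡ suc (rho c u)
    quiet-balance u =
      subst (λ k → k + rho c (cw u) + 𝟙[ ID u ≤ rho c u ] ≡ suc (rho c u)) (quiet (cw u)) (balanced u)
    rho≤rho-cw : ∀ u → rho c u ≤ rho c (cw u)
    rho≤rho-cw u = m+n≡1+o∧n≤1⇒o≤m (quiet-balance u) (𝟙≤1 (ID u) (rho c u))
    rho-cw≤rho : rho c (cw v) ≤ rho c v
    rho-cw≤rho = reverse-around-ring {R = _≤_} ≤-refl ≤-trans (rho c) rho≤rho-cw v
    rho<rho-cw : rho c v < rho c (cw v)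
    rho<rho-cw = ≤-reflexive (begin
      suc (rho c v)                         ≡⟨ sym (quiet-balance v) ⟩
      rho c (cw v) + 𝟙[ ID v ≤ rho c v ]    ≡⟨ cong (rho c (cw v) +_) (𝟙-no (≰⇒> ID≰rho)) ⟩
      rho c (cw v) + 0                      ≡⟨ +-identityʳ _ ⟩
      rho c (cw v)                          ∎)

  balanced⇒ID≤rho⇒quiescent : (∀ v → ID v ≤ rho c v) → Quiescent c
  balanced⇒ID≤rho⇒quiescent ID≤rho w = subst (λ x → chan c x ≡ 0) (cw-ccw w) (chan-cw≡0 (ccw w))
    where
    open ≡-Reasoning
    delivered-all : ∀ u → chan c (cw u) + rho c (cw u) ≡ rho c u
    delivered-all u = +-cancelʳ-≡ 1 _ _ (begin
      chan c (cw u) + rho c (cw u) + 1                       ≡⟨ cong (_ +_) (sym (𝟙-yes (ID≤rho u))) ⟩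
      chan c (cw u) + rho c (cw u) + 𝟙[ ID u ≤ rho c u ]     ≡⟨ balanced u ⟩
      suc (rho c u)                                          ≡⟨ +-comm 1 (rho c u) ⟩
      rho c u + 1                                            ∎)
    rho-cw≤rho : ∀ u → rho c (cw u) ≤ rho c u
    rho-cw≤rho u = subst (rho c (cw u) ≤_) (delivered-all u) (m≤n+m _ _)
    chan-cw≡0 : ∀ u → chan c (cw u) ≡ 0
    chan-cw≡0 u = m+n≤n⇒m≡0 (subst (_≤ rho c (cw u)) (sym (delivered-all u))
      (reverse-around-ring {R = _≥_} ≤-refl (flip ≤-trans) (rho c) rho-cw≤rho u))

corollary3p5 : (n : ℕ) (ID : Fin n → ℕ) → Injective _≡_ _≡_ ID → (∀ v → 0 < ID v) →
    (c : Config n) → Reachable ID c → (Quiescent c ⇔ (∀ v → ID v ≤ rho c v))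
corollary3p5 zero    ID _ _    c _     = mk⇔ (λ _ ()) (λ _ ())
corollary3p5 (suc m) ID _ ID>0 c reach =
  mk⇔ (balanced⇒quiescent⇒ID≤rho ID c balanced) (balanced⇒ID≤rho⇒quiescent ID c balanced)
  where
  balanced : Balanced ID c
  balanced = invariants⇒balanced ID {c} (steps-preserve-invariants ID reach (initial-invariants ID ID>0))
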